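{- For any positive integers $n,\lambda$ with $n\geq \lambda$, there exists a directed graph $G$ on $n$ vertices with a source $s$, a sink $t$, and an $(s,t)$-min-cut of size $\lambda$, such that any dual fault-tolerant min-cut oracle for $G$ requires $\Omega(\lambda n)$ space.
   Context: Graphs are directed unweighted multigraphs with unit edge capacities. A dual fault-tolerant min-cut oracle for $G$ is a data structure that, given any set $F$ of two edges of $G$, reports the size of an $(s,t)$-min-cut in $G-F$ (the graph with the edges of $F$ deleted). -}

module Defs where

open import Data.Nat using (ℕ; zero; suc; _+_; _*_; _∸_; _≤_)
open import Data.Bool using (Bool; true; false; if_then_else_; _∧_; not)
open import Data.Fin using (Fin; _≟_)
open import Data.Fin.Subset using (Subset; _∈_; _∉_)
open import Data.List using (List; map; allFin; length)
open import Data.Nat.ListAction using (sum)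
open import Data.Product using (_×_; Σ; ∃-syntax; _,_)
open import Data.Vec using (lookup)
open import Relation.Nullary using (does)
open import Relation.Binary.PropositionalEquality using (_≡_)

-- A directed multigraph on the vertex set Fin n, given by edge multiplicities:
-- mult u v = number of parallel edges u → v (unit capacity each).
Multigraph : ℕ → Set
Multigraph n = Fin n → Fin n → ℕ

Σᵥ : ∀ {n} → (Fin n → ℕ) → ℕ
Σᵥ {n} f = sum (map f (allFin n))

cutValue : ∀ {n} → Multigraph n → Subset n → ℕ
cutValue {n} G S =
  Σᵥ (λ u → Σᵥ (λ v → if lookup S u ∧ not (lookup S v) then G u v else 0))

IsMinCutSize : ∀ {n} → Multigraph n → Fin n → Fin n → ℕ → Set
IsMinCutSize G s t k =
  (∃[ S ] (s ∈ S × t ∉ S × cutValue G S ≡ k))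
  × (∀ S → s ∈ S → t ∉ S → k ≤ cutValue G S)

-- an edge is named by its endpoints (parallel edges are interchangeable)
Edge : ℕ → Set
Edge n = Fin n × Fin n

eqE : ∀ {n} → Edge n → Edge n → ℕ
eqE (a , b) (u , v) = if does (a ≟ u) ∧ does (b ≟ v) then 1 else 0

occ : ∀ {n} → Edge n → Edge n → Fin n → Fin n → ℕ
occ e₁ e₂ u v = eqE e₁ (u , v) + eqE e₂ (u , v)

-- F = {e₁, e₂} is a set of two (distinct) edges of G
ValidFailure : ∀ {n} → Multigraph n → Edge n → Edge n → Set
ValidFailure G e₁ e₂ = ∀ u v → occ e₁ e₂ u v ≤ G u v

deleteEdges : ∀ {n} → Multigraph n → Edge n → Edge n → Multigraph n
deleteEdges G e₁ e₂ u v = G u v ∸ occ e₁ e₂ u v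

record Instance (n : ℕ) : Set where
  constructor inst
  field
    graph  : Multigraph n
    source : Fin n
    sink   : Fin n
open Instance public

HasMinCut : ∀ {n} → Instance n → ℕ → Set
HasMinCut I λ' = IsMinCutSize (graph I) (source I) (sink I) λ'

-- A dual fault-tolerant min-cut oracle scheme for the class of n-vertex instances
-- with min-cut λ: the stored data structure is a bit string enc I, and the query
-- procedure q answers every dual-failure query from the stored bits alone.
CorrectOracle : ∀ n → ℕ → (Instance n → List Bool) → (List Bool → Edge n → Edge n → ℕ) → Set
CorrectOracle n λ' enc q =
  ∀ (I : Instance n) → HasMinCut I λ' →
  ∀ e₁ e₂ → ValidFailure (graph I) e₁ e₂ →
  IsMinCutSize (deleteEdges (graph I) e₁ e₂) (source I) (sink I) (q (enc I) e₁ e₂)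

module Submission where

-- The instances are chains of k gadgets between consecutive entry vertices, followed by λ′
-- parallel edges into the sink.  A gadget joins its entry to the next one by d parallel
-- edges and by 2h two-edge paths, through h row and h column vertices, where
-- 2h + d = λ′ + 1; on top of this it carries an arbitrary set of chords row → column.
-- Any cut crossing a gadget pays at least λ′ + 1, so the min-cut is λ′.  Failing the
-- edges row j → exit and entry → column i keeps every cut at least λ′ if the chord
-- row j → column i is present (the chord reroutes both paths), and otherwise there is a
-- cut of value λ′ + 1 crossing both failed edges.  So the oracle's answers recover all
-- k h² chords, and with k h² ≈ λ′ n / 42 one of the 2^(k h²) instances needs about
-- λ′ n / 42 bits.

open import Defs
open import Data.Empty using (⊥-elim)
open import Data.Bool using (Bool; true; false; if_then_else_; _∧_; _∨_; not)
open import Data.Bool.Properties using (if-eta)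
open import Data.Fin using (Fin; zero; suc; _≟_; toℕ; fromℕ<; combine; remQuot; finToFun; funToFin)
open import Data.Fin.Properties as Finₚ
  using (toℕ-fromℕ<; fromℕ<-injective; fromℕ<-toℕ; toℕ<n; toℕ-combine; combine-remQuot; funToFin-finToFin; any?; pigeonhole)
open import Data.Fin.Subset using (Subset; _∈_; _∉_)
open import Data.List using (List; []; _∷_; map; allFin; length)
open import Data.List.Properties using (map-cong; map-tabulate)
open import Data.Nat as ℕ
  using (ℕ; zero; suc; _+_; _*_; _∸_; _^_; _⊓_; ⌊_/2⌋; ⌈_/2⌉; _≤_; _<_; z≤n; s≤s; s≤s⁻¹; _≤?_; _<?_)
open import Data.Nat.Binary as ℕᵇ using (ℕᵇ; 2[1+_]; 1+[2_])
open import Data.Nat.Binary.Properties using (toℕ-injective; 1+[2_]-injective; 2[1+_]-injective)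
open import Data.Nat.DivMod using (_mod_; _/_; _%_; m<n⇒m%n≡m; m≡m%n+[m/n]*n; m%n<n; m/n*n≤m; m≥n⇒m/n>0)
open import Data.Nat.ListAction using (sum)
open import Data.Nat.Tactic.RingSolver using (solve-∀)
open import Data.Nat.Properties hiding (_≟_)
open import Algebra.Properties.CommutativeSemigroup +-commutativeSemigroup
  using () renaming (interchange to +-interchange)
open import Data.Product using (_×_; _,_; ∃-syntax; proj₁; proj₂)
open import Data.Vec as Vec using (lookup)
open import Data.Vec.Properties using (lookup∘tabulate; []=⇒lookup; lookup⇒[]=)
open import Function using (_∘_; id)
open import Relation.Nullary using (does; yes; no)
open import Relation.Nullary.Decidable using (dec-true; dec-false)
open import Relation.Binary.PropositionalEquality
open import Relation.Binary.Definitions using (tri<; tri≈; tri>)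

Σ< : ℕ → (ℕ → ℕ) → ℕ
Σ< zero    f = 0
Σ< (suc k) f = Σ< k f + f k

private
  restrict : ∀ {k} {P : ℕ → Set} → (∀ i → i < suc k → P i) → ∀ i → i < k → P i
  restrict h i i<k = h i (m<n⇒m<1+n i<k)

Σ<-cong : ∀ k {f g : ℕ → ℕ} → (∀ i → i < k → f i ≡ g i) → Σ< k f ≡ Σ< k g
Σ<-cong zero    h = refl
Σ<-cong (suc k) h = cong₂ _+_ (Σ<-cong k (restrict h)) (h k (n<1+n k))

Σ<-mono : ∀ k {f g : ℕ → ℕ} → (∀ i → i < k → f i ≤ g i) → Σ< k f ≤ Σ< k g
Σ<-mono zero    h = z≤n
Σ<-mono (suc k) h = +-mono-≤ (Σ<-mono k (restrict h)) (h k (n<1+n k))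

Σ<-const : ∀ k c {f : ℕ → ℕ} → (∀ i → i < k → f i ≡ c) → Σ< k f ≡ k * c
Σ<-const zero    c h = refl
Σ<-const (suc k) c h =
  trans (cong₂ _+_ (Σ<-const k c (restrict h)) (h k (n<1+n k))) (+-comm (k * c) c)

Σ<-zero : ∀ k {f : ℕ → ℕ} → (∀ i → i < k → f i ≡ 0) → Σ< k f ≡ 0
Σ<-zero k h = trans (Σ<-const k 0 h) (*-zeroʳ k)

Σ<-*ˡ : ∀ k c (f : ℕ → ℕ) → Σ< k (λ i → c * f i) ≡ c * Σ< k f
Σ<-*ˡ zero    c f = sym (*-zeroʳ c)
Σ<-*ˡ (suc k) c f =
  trans (cong (_+ c * f k) (Σ<-*ˡ k c f)) (sym (*-distribˡ-+ c (Σ< k f) (f k)))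

Σ<-const-≤ : ∀ k c {f : ℕ → ℕ} → (∀ i → i < k → c ≤ f i) → k * c ≤ Σ< k f
Σ<-const-≤ k c h = subst (_≤ _) (Σ<-const k c {λ _ → c} (λ _ _ → refl)) (Σ<-mono k h)

Σ<-mono-+ : ∀ k {f g : ℕ → ℕ} j x → (∀ i → i < k → f i ≤ g i) → j < k →
            f j + x ≤ g j → Σ< k f + x ≤ Σ< k g
Σ<-mono-+ (suc k) {f} {g} j x h j<k hj with j ℕ.≟ k
... | yes refl = begin
  Σ< j f + f j + x   ≡⟨ +-assoc (Σ< j f) (f j) x ⟩
  Σ< j f + (f j + x) ≤⟨ +-mono-≤ (Σ<-mono j (restrict h)) hj ⟩
  Σ< j g + g j       ∎
  where open ≤-Reasoning
... | no j≢k = begin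
  Σ< k f + f k + x   ≡⟨ +-assoc (Σ< k f) (f k) x ⟩
  Σ< k f + (f k + x) ≡⟨ cong (Σ< k f +_) (+-comm (f k) x) ⟩
  Σ< k f + (x + f k) ≡⟨ +-assoc (Σ< k f) x (f k) ⟨
  Σ< k f + x + f k   ≤⟨ +-mono-≤ (Σ<-mono-+ k j x (restrict h) (≤∧≢⇒< (s≤s⁻¹ j<k) j≢k) hj) (h k (n<1+n k)) ⟩
  Σ< k g + g k       ∎
  where open ≤-Reasoning

Σ<-single : ∀ k (f : ℕ → ℕ) j → j < k → f j ≤ Σ< k f
Σ<-single k f j j<k =
  subst (_≤ Σ< k f) (cong (_+ f j) (Σ<-zero k {λ _ → 0} (λ _ _ → refl)))
        (Σ<-mono-+ k j (f j) (λ _ _ → z≤n) j<k ≤-refl)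

Σ<-single-≡ : ∀ k {f : ℕ → ℕ} j → j < k → (∀ i → i < k → i ≢ j → f i ≡ 0) → Σ< k f ≡ f j
Σ<-single-≡ (suc k) {f} j j<k h with j ℕ.≟ k
... | yes refl = cong (_+ f j) (Σ<-zero j (λ i i<j → h i (m<n⇒m<1+n i<j) (<⇒≢ i<j)))
... | no j≢k =
  trans (cong₂ _+_ (Σ<-single-≡ k j (≤∧≢⇒< (s≤s⁻¹ j<k) j≢k) (restrict h)) (h k (n<1+n k) (j≢k ∘ sym)))
        (+-identityʳ (f j))

-- Cut values

module _ {n : ℕ} where

  Σᵥ-cong : {f g : Fin n → ℕ} → (∀ x → f x ≡ g x) → Σᵥ f ≡ Σᵥ g
  Σᵥ-cong h = cong sum (map-cong h (allFin n))

  Σᵥ-+ : (f g : Fin n → ℕ) → Σᵥ (λ x → f x + g x) ≡ Σᵥ f + Σᵥ g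
  Σᵥ-+ f g = sum-map-+ (allFin n)
    where
    sum-map-+ : ∀ xs → sum (map (λ x → f x + g x) xs) ≡ sum (map f xs) + sum (map g xs)
    sum-map-+ []       = refl
    sum-map-+ (x ∷ xs) = trans (cong (f x + g x +_) (sum-map-+ xs))
                               (+-interchange (f x) (g x) (sum (map f xs)) (sum (map g xs)))

  Σᵥ-zero : Σᵥ {n} (λ _ → 0) ≡ 0
  Σᵥ-zero = sum-map-zero (allFin n)
    where
    sum-map-zero : (xs : List (Fin n)) → sum (map (λ _ → 0) xs) ≡ 0
    sum-map-zero []       = refl
    sum-map-zero (_ ∷ xs) = sum-map-zero xs

Σᵥ-suc : ∀ {n} (f : Fin (suc n) → ℕ) → Σᵥ f ≡ f zero + Σᵥ (f ∘ suc)
Σᵥ-suc f = cong (λ xs → f zero + sum xs)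
  (trans (map-tabulate suc f) (sym (map-tabulate id (f ∘ suc))))

Σᵥ-indicator : ∀ {n} (b : Fin n) (f : Fin n → ℕ) → Σᵥ (λ v → if does (b ≟ v) then f v else 0) ≡ f b
Σᵥ-indicator {suc n} zero f =
  trans (Σᵥ-suc (λ v → if does (zero ≟ v) then f v else 0))
        (trans (cong (f zero +_) (Σᵥ-zero {n})) (+-identityʳ (f zero)))
Σᵥ-indicator (suc b) f = trans (Σᵥ-suc (λ v → if does (suc b ≟ v) then f v else 0)) (Σᵥ-indicator b (f ∘ suc))

module _ {n : ℕ} where

  edge : Fin n → Fin n → Multigraph n
  edge a b u v = eqE (a , b) (u , v)

  infixl 6 _⊕_
  _⊕_ : Multigraph n → Multigraph n → Multigraph n
  (G ⊕ H) u v = G u v + H u v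

  empty : Multigraph n
  empty u v = 0

  copies : ℕ → Multigraph n → Multigraph n
  copies d G u v = d * G u v

  ⨁< : ℕ → (ℕ → Multigraph n) → Multigraph n
  ⨁< k Gs u v = Σ< k (λ g → Gs g u v)

  when : Bool → Multigraph n → Multigraph n
  when b G u v = if b then G u v else 0

  crosses : Subset n → Fin n → Fin n → ℕ
  crosses S a b = if lookup S a ∧ not (lookup S b) then 1 else 0

  cutValue-cong : ∀ {G H : Multigraph n} S → (∀ u v → G u v ≡ H u v) → cutValue G S ≡ cutValue H S
  cutValue-cong S h = Σᵥ-cong λ u → Σᵥ-cong λ v →
    cong (λ x → if lookup S u ∧ not (lookup S v) then x else 0) (h u v)

  cutValue-⊕ : ∀ G H S → cutValue (G ⊕ H) S ≡ cutValue G S + cutValue H S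
  cutValue-⊕ G H S =
    trans (Σᵥ-cong λ u → trans (Σᵥ-cong λ v → if-+ (lookup S u ∧ not (lookup S v)))
                               (Σᵥ-+ (row G u) (row H u)))
          (Σᵥ-+ (λ u → Σᵥ (row G u)) (λ u → Σᵥ (row H u)))
    where
    row : Multigraph n → Fin n → Fin n → ℕ
    row K u v = if lookup S u ∧ not (lookup S v) then K u v else 0
    if-+ : ∀ {x y} c → (if c then x + y else 0) ≡ (if c then x else 0) + (if c then y else 0)
    if-+ true  = refl
    if-+ false = refl

  cutValue-empty : ∀ S → cutValue empty S ≡ 0
  cutValue-empty S =
    trans (Σᵥ-cong λ u → trans (Σᵥ-cong λ v → if-eta (lookup S u ∧ not (lookup S v))) (Σᵥ-zero {n})) (Σᵥ-zero {n})

  cutValue-copies : ∀ d G S → cutValue (copies d G) S ≡ d * cutValue G S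
  cutValue-copies zero    G S = cutValue-empty S
  cutValue-copies (suc d) G S =
    trans (cutValue-⊕ G (copies d G) S) (cong (cutValue G S +_) (cutValue-copies d G S))

  cutValue-⨁< : ∀ k Gs S → cutValue (⨁< k Gs) S ≡ Σ< k (λ g → cutValue (Gs g) S)
  cutValue-⨁< zero    Gs S = cutValue-empty S
  cutValue-⨁< (suc k) Gs S =
    trans (cutValue-⊕ (⨁< k Gs) (Gs k) S) (cong (_+ cutValue (Gs k) S) (cutValue-⨁< k Gs S))

  cutValue-when : ∀ b G S → cutValue (when b G) S ≡ (if b then cutValue G S else 0)
  cutValue-when true  G S = refl
  cutValue-when false G S = cutValue-empty S

  cutValue-edge : ∀ a b S → cutValue (edge a b) S ≡ crosses S a b
  cutValue-edge a b S =
    trans (Σᵥ-cong λ u → trans (Σᵥ-cong λ v → reorder (lookup S u ∧ not (lookup S v)) (does (a ≟ u)) (does (b ≟ v)))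
                               (Σᵥ-indicator b _))
          (Σᵥ-indicator a _)
    where
    reorder : ∀ c p q → (if c then (if p ∧ q then 1 else 0) else 0)
                      ≡ (if q then (if p then (if c then 1 else 0) else 0) else 0)
    reorder true  true  true  = refl
    reorder true  true  false = refl
    reorder true  false true  = refl
    reorder true  false false = refl
    reorder false true  true  = refl
    reorder false true  false = refl
    reorder false false true  = refl
    reorder false false false = refl

  cutValue-path : ∀ a x b S → cutValue (edge a x ⊕ edge x b) S ≡ crosses S a x + crosses S x b
  cutValue-path a x b S = trans (cutValue-⊕ _ _ S) (cong₂ _+_ (cutValue-edge a x S) (cutValue-edge x b S))

  cutValue-deleteEdges : ∀ G a b c e S → ValidFailure G (a , b) (c , e) →
    cutValue G S ≡ cutValue (deleteEdges G (a , b) (c , e)) S + (crosses S a b + crosses S c e)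
  cutValue-deleteEdges G a b c e S valid = begin
    cutValue G S
      ≡⟨ cutValue-cong S (λ u v → sym (m∸n+n≡m (valid u v))) ⟩
    cutValue (deleteEdges G (a , b) (c , e) ⊕ (edge a b ⊕ edge c e)) S
      ≡⟨ cutValue-⊕ _ _ S ⟩
    cutValue (deleteEdges G (a , b) (c , e)) S + cutValue (edge a b ⊕ edge c e) S
      ≡⟨ cong (cutValue (deleteEdges G (a , b) (c , e)) S +_)
              (trans (cutValue-⊕ _ _ S) (cong₂ _+_ (cutValue-edge a b S) (cutValue-edge c e S))) ⟩
    cutValue (deleteEdges G (a , b) (c , e)) S + (crosses S a b + crosses S c e) ∎
    where open ≡-Reasoning

  crosses-triangle : ∀ S a x b → crosses S a b ≤ crosses S a x + crosses S x b
  crosses-triangle S a x b with lookup S a | lookup S x | lookup S b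
  ... | true  | true  | true  = z≤n
  ... | true  | true  | false = s≤s z≤n
  ... | true  | false | true  = z≤n
  ... | true  | false | false = s≤s z≤n
  ... | false | _     | _     = z≤n

  -- Two paths u → x → w and u → y → w joined by a chord x → y: a cut pays for
  -- x → w and u → y at most what it pays for u → w, the two detours and the chord.
  crosses-rhombus : ∀ S u x y w →
    crosses S x w + crosses S u y ≤
      crosses S u w + (crosses S u x + crosses S x w ∸ crosses S u w)
                    + (crosses S u y + crosses S y w ∸ crosses S u w) + crosses S x y
  crosses-rhombus S u x y w with lookup S u | lookup S x | lookup S y | lookup S w
  ... | true  | true  | true  | true  = ≤ᵇ⇒≤ _ _ _
  ... | true  | true  | true  | false = ≤ᵇ⇒≤ _ _ _
  ... | true  | true  | false | true  = ≤ᵇ⇒≤ _ _ _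
  ... | true  | true  | false | false = ≤ᵇ⇒≤ _ _ _
  ... | true  | false | true  | true  = ≤ᵇ⇒≤ _ _ _
  ... | true  | false | true  | false = ≤ᵇ⇒≤ _ _ _
  ... | true  | false | false | true  = ≤ᵇ⇒≤ _ _ _
  ... | true  | false | false | false = ≤ᵇ⇒≤ _ _ _
  ... | false | true  | true  | true  = ≤ᵇ⇒≤ _ _ _
  ... | false | true  | true  | false = ≤ᵇ⇒≤ _ _ _
  ... | false | true  | false | true  = ≤ᵇ⇒≤ _ _ _
  ... | false | true  | false | false = ≤ᵇ⇒≤ _ _ _
  ... | false | false | true  | true  = ≤ᵇ⇒≤ _ _ _
  ... | false | false | true  | false = ≤ᵇ⇒≤ _ _ _
  ... | false | false | false | true  = ≤ᵇ⇒≤ _ _ _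
  ... | false | false | false | false = ≤ᵇ⇒≤ _ _ _

  crosses-≡1 : ∀ S a b → lookup S a ≡ true → lookup S b ≡ false → crosses S a b ≡ 1
  crosses-≡1 S a b a∈S b∉S rewrite a∈S | b∉S = refl

  crosses-through : ∀ S a x b → lookup S a ≡ true → lookup S b ≡ false → crosses S a x + crosses S x b ≡ 1
  crosses-through S a x b a∈S b∉S rewrite a∈S | b∉S with lookup S x
  ... | true  = refl
  ... | false = refl

-- The hard instances

-- Gadget g occupies the positions g·width (its entry), then h rows and h columns; its exit
-- is the entry of gadget g + 1.  The source is position 0 and the sink position m.
module Layout (m h : ℕ) where

  n : ℕ
  n = suc m

  vertex : ℕ → Fin n
  vertex N = N mod n

  toℕ-vertex : ∀ {N} → N ≤ m → toℕ (vertex N) ≡ N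
  toℕ-vertex {N} N≤m = trans (toℕ-fromℕ< _) (m<n⇒m%n≡m (s≤s N≤m))

  width : ℕ
  width = suc (h + h)

  entry : ℕ → Fin n
  entry g = vertex (g * width)

  row col : ℕ → ℕ → Fin n
  row g j = vertex (g * width + suc j)
  col g i = vertex (g * width + suc (h + i))

  t : Fin n
  t = vertex m

module Construction (m λ′ h d k : ℕ) (β : ℕ → ℕ → ℕ → Bool) where

  open Layout m h public

  path : Fin n → Fin n → Fin n → Multigraph n
  path a x b = edge a x ⊕ edge x b

  gadget : ℕ → Multigraph n
  gadget g = ⨁< h (λ j → path (entry g) (row g j) (entry (suc g)))
           ⊕ ⨁< h (λ i → path (entry g) (col g i) (entry (suc g)))
           ⊕ copies d (edge (entry g) (entry (suc g)))
           ⊕ ⨁< h (λ j → ⨁< h (λ i → when (β g j i) (edge (row g j) (col g i))))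

  network : Multigraph n
  network = ⨁< k gadget ⊕ copies λ′ (edge (entry k) t)

  hardInstance : Instance n
  hardInstance = inst network (vertex 0) t

  failedNetwork : ℕ → ℕ → ℕ → Multigraph n
  failedNetwork g j i = deleteEdges network (row g j , entry (suc g)) (entry g , col g i)

  failures-valid : ∀ {g j i} → g < k → j < h → i < h →
    ValidFailure network (row g j , entry (suc g)) (entry g , col g i)
  failures-valid {g} {j} {i} g<k j<h i<h u v = begin
    edge (row g j) (entry (suc g)) u v + edge (entry g) (col g i) u v
      ≤⟨ +-mono-≤ (m≤n+m _ (edge (entry g) (row g j) u v)) (m≤m+n _ (edge (col g i) (entry (suc g)) u v)) ⟩
    path (entry g) (row g j) (entry (suc g)) u v + path (entry g) (col g i) (entry (suc g)) u v
      ≤⟨ +-mono-≤ (Σ<-single h (λ j → path (entry g) (row g j) (entry (suc g)) u v) j j<h)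
                  (Σ<-single h (λ i → path (entry g) (col g i) (entry (suc g)) u v) i i<h) ⟩
    ⨁< h (λ j → path (entry g) (row g j) (entry (suc g))) u v + ⨁< h (λ i → path (entry g) (col g i) (entry (suc g))) u v
      ≤⟨ ≤-trans (m≤m+n _ _) (m≤m+n _ _) ⟩
    gadget g u v                   ≤⟨ Σ<-single k (λ g → gadget g u v) g g<k ⟩
    ⨁< k gadget u v                ≤⟨ m≤m+n _ _ ⟩
    network u v                    ∎
    where open ≤-Reasoning

  through : Subset n → ℕ → Fin n → ℕ
  through S g x = crosses S (entry g) x + crosses S x (entry (suc g))

  link : Subset n → ℕ → ℕ
  link S g = crosses S (entry g) (entry (suc g))

  bitCrossings : Subset n → ℕ → ℕ
  bitCrossings S g = Σ< h λ j → Σ< h λ i → if β g j i then crosses S (row g j) (col g i) else 0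

  cutValue-gadget : ∀ S g → cutValue (gadget g) S ≡
    Σ< h (λ j → through S g (row g j)) + Σ< h (λ i → through S g (col g i)) + d * link S g + bitCrossings S g
  cutValue-gadget S g =
    trans (cutValue-⊕ _ _ S)
      (cong₂ _+_ (trans (cutValue-⊕ _ _ S)
                   (cong₂ _+_ (trans (cutValue-⊕ _ _ S) (cong₂ _+_ (paths (row g)) (paths (col g))))
                              (trans (cutValue-copies d _ S) (cong (d *_) (cutValue-edge _ _ S)))))
                 (trans (cutValue-⨁< h _ S) (Σ<-cong h λ j _ →
                   trans (cutValue-⨁< h _ S) (Σ<-cong h λ i _ →
                     trans (cutValue-when (β g j i) _ S) (cong (if β g j i then_else 0) (cutValue-edge _ _ S))))))
    where
    paths : ∀ (x : ℕ → Fin n) →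
      cutValue (⨁< h (λ j → path (entry g) (x j) (entry (suc g)))) S ≡ Σ< h (λ j → through S g (x j))
    paths x = trans (cutValue-⨁< h _ S) (Σ<-cong h λ j _ → cutValue-path _ _ _ S)

  cutValue-network : ∀ S → cutValue network S ≡ Σ< k (λ g → cutValue (gadget g) S) + λ′ * crosses S (entry k) t
  cutValue-network S =
    trans (cutValue-⊕ _ _ S)
          (cong₂ _+_ (cutValue-⨁< k gadget S) (trans (cutValue-copies λ′ _ S) (cong (λ′ *_) (cutValue-edge _ _ S))))

  Σ<-through-≥ : ∀ S g (x : ℕ → Fin n) j → j < h →
    h * link S g + (through S g (x j) ∸ link S g) ≤ Σ< h (λ i → through S g (x i))
  Σ<-through-≥ S g x j j<h =
    subst (λ z → z + (through S g (x j) ∸ link S g) ≤ Σ< h (λ i → through S g (x i)))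
          (Σ<-const h (link S g) {λ _ → link S g} (λ _ _ → refl))
      (Σ<-mono-+ h j _ (λ i _ → crosses-triangle S _ (x i) _) j<h
        (≤-reflexive (m+[n∸m]≡n (crosses-triangle S _ (x j) _))))

  gadget-≥ : ∀ S g → (h + h + d) * link S g ≤ cutValue (gadget g) S
  gadget-≥ S g = begin
    (h + h + d) * r                                  ≡⟨ solve-∀-distrib h d r ⟩
    h * r + h * r + d * r                            ≤⟨ +-monoˡ-≤ (d * r) (+-mono-≤ (bound (row g)) (bound (col g))) ⟩
    Σ< h (λ j → through S g (row g j)) + Σ< h (λ i → through S g (col g i)) + d * r
                                                     ≤⟨ m≤m+n _ (bitCrossings S g) ⟩
    Σ< h (λ j → through S g (row g j)) + Σ< h (λ i → through S g (col g i)) + d * r + bitCrossings S g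
                                                     ≡⟨ cutValue-gadget S g ⟨
    cutValue (gadget g) S                            ∎
    where
    open ≤-Reasoning
    r = link S g
    solve-∀-distrib : ∀ h d r → (h + h + d) * r ≡ h * r + h * r + d * r
    solve-∀-distrib = solve-∀
    bound : ∀ (x : ℕ → Fin n) → h * r ≤ Σ< h (λ i → through S g (x i))
    bound x = Σ<-const-≤ h r (λ i _ → crosses-triangle S _ (x i) _)

  links-≥ : ∀ S j → crosses S (entry 0) t ≤ Σ< j (link S) + crosses S (entry j) t
  links-≥ S zero    = ≤-refl
  links-≥ S (suc j) = begin
    crosses S (entry 0) t                                     ≤⟨ links-≥ S j ⟩
    Σ< j (link S) + crosses S (entry j) t                     ≤⟨ +-monoʳ-≤ (Σ< j (link S)) (crosses-triangle S _ (entry (suc j)) t) ⟩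
    Σ< j (link S) + (link S j + crosses S (entry (suc j)) t)  ≡⟨ +-assoc (Σ< j (link S)) _ _ ⟨
    Σ< (suc j) (link S) + crosses S (entry (suc j)) t         ∎
    where open ≤-Reasoning

  crosses-source-sink : ∀ S → vertex 0 ∈ S → t ∉ S → crosses S (vertex 0) t ≡ 1
  crosses-source-sink S s∈S t∉S with lookup S t in t-lookup
  ... | true  = ⊥-elim (t∉S (lookup⇒[]= t S t-lookup))
  ... | false rewrite []=⇒lookup s∈S = refl

  -- Every source-sink cut crosses one of the links of the chain entry 0 → ⋯ → entry k → t.
  cut-≥ : ∀ S → vertex 0 ∈ S → t ∉ S → ∀ x →
    Σ< k (λ g → λ′ * link S g) + x ≤ Σ< k (λ g → cutValue (gadget g) S) → λ′ + x ≤ cutValue network S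
  cut-≥ S s∈S t∉S x gadgets-≥ = begin
    λ′ + x
      ≡⟨ cong (_+ x) (trans (sym (*-identityʳ λ′)) (cong (λ′ *_) (sym (crosses-source-sink S s∈S t∉S)))) ⟩
    λ′ * crosses S (entry 0) t + x                            ≤⟨ +-monoˡ-≤ x (*-monoʳ-≤ λ′ (links-≥ S k)) ⟩
    λ′ * (Σ< k (link S) + last) + x                           ≡⟨ cong (_+ x) (*-distribˡ-+ λ′ _ last) ⟩
    λ′ * Σ< k (link S) + λ′ * last + x                        ≡⟨ +-assoc (λ′ * Σ< k (link S)) _ x ⟩
    λ′ * Σ< k (link S) + (λ′ * last + x)                      ≡⟨ cong (λ′ * Σ< k (link S) +_) (+-comm (λ′ * last) x) ⟩
    λ′ * Σ< k (link S) + (x + λ′ * last)                      ≡⟨ +-assoc (λ′ * Σ< k (link S)) x _ ⟨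
    λ′ * Σ< k (link S) + x + λ′ * last                        ≡⟨ cong (λ z → z + x + λ′ * last) (Σ<-*ˡ k λ′ (link S)) ⟨
    Σ< k (λ g → λ′ * link S g) + x + λ′ * last                ≤⟨ +-monoˡ-≤ _ gadgets-≥ ⟩
    Σ< k (λ g → cutValue (gadget g) S) + λ′ * last            ≡⟨ cutValue-network S ⟨
    cutValue network S                                        ∎
    where
    open ≤-Reasoning
    last = crosses S (entry k) t

  bitCrossings-≥ : ∀ S {g j i} → j < h → i < h → β g j i ≡ true → crosses S (row g j) (col g i) ≤ bitCrossings S g
  bitCrossings-≥ S {g} {j} {i} j<h i<h bit =
    ≤-trans (≤-reflexive (cong (if_then crosses S (row g j) (col g i) else 0) (sym bit)))
      (≤-trans (Σ<-single h (λ i → if β g j i then crosses S (row g j) (col g i) else 0) i i<h)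
               (Σ<-single h (λ j → Σ< h λ i → if β g j i then crosses S (row g j) (col g i) else 0) j j<h))

  module _ (budget : h + h + d ≡ suc λ′) where

    gadget-≥-λ′ : ∀ S g → λ′ * link S g ≤ cutValue (gadget g) S
    gadget-≥-λ′ S g = ≤-trans (*-monoˡ-≤ (link S g) (≤-trans (n≤1+n λ′) (≤-reflexive (sym budget)))) (gadget-≥ S g)

    network-≥ : ∀ S → vertex 0 ∈ S → t ∉ S → λ′ ≤ cutValue network S
    network-≥ S s∈S t∉S =
      subst (_≤ cutValue network S) (+-identityʳ λ′)
        (cut-≥ S s∈S t∉S 0 (subst (_≤ Σ< k (λ g → cutValue (gadget g) S)) (sym (+-identityʳ _))
                                  (Σ<-mono k (λ g _ → gadget-≥-λ′ S g))))

    -- The chord row j → column i takes the place of both failed edges.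
    gadget-≥-failures : ∀ S {g j i} → j < h → i < h → β g j i ≡ true →
      λ′ * link S g + (crosses S (row g j) (entry (suc g)) + crosses S (entry g) (col g i)) ≤ cutValue (gadget g) S
    gadget-≥-failures S {g} {j} {i} j<h i<h bit = begin
      λ′ * r + (crosses S (row g j) (entry (suc g)) + crosses S (entry g) (col g i))
        ≤⟨ +-monoʳ-≤ (λ′ * r) (crosses-rhombus S (entry g) (row g j) (col g i) (entry (suc g))) ⟩
      λ′ * r + (r + A + B + X)               ≡⟨ regroup₁ λ′ r A B X ⟩
      suc λ′ * r + (A + B + X)               ≡⟨ cong (λ c → c * r + (A + B + X)) (sym budget) ⟩
      (h + h + d) * r + (A + B + X)          ≡⟨ regroup₂ h d r A B X ⟩
      h * r + A + (h * r + B) + d * r + X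
        ≤⟨ +-mono-≤ (+-monoˡ-≤ (d * r) (+-mono-≤ (Σ<-through-≥ S g (row g) j j<h) (Σ<-through-≥ S g (col g) i i<h)))
                    (bitCrossings-≥ S j<h i<h bit) ⟩
      Σ< h (λ j → through S g (row g j)) + Σ< h (λ i → through S g (col g i)) + d * r + bitCrossings S g
                                             ≡⟨ cutValue-gadget S g ⟨
      cutValue (gadget g) S                  ∎
      where
      open ≤-Reasoning
      r = link S g
      A = through S g (row g j) ∸ r
      B = through S g (col g i) ∸ r
      X = crosses S (row g j) (col g i)
      regroup₁ : ∀ l r A B X → l * r + (r + A + B + X) ≡ suc l * r + (A + B + X)
      regroup₁ = solve-∀
      regroup₂ : ∀ h d r A B X → (h + h + d) * r + (A + B + X) ≡ h * r + A + (h * r + B) + d * r + X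
      regroup₂ = solve-∀

    failedNetwork-≥ : ∀ {g j i} → g < k → j < h → i < h → β g j i ≡ true →
      ∀ S → vertex 0 ∈ S → t ∉ S → λ′ ≤ cutValue (failedNetwork g j i) S
    failedNetwork-≥ {g} {j} {i} g<k j<h i<h bit S s∈S t∉S = +-cancelʳ-≤ x λ′ _ (begin
      λ′ + x                            ≤⟨ cut-≥ S s∈S t∉S x (Σ<-mono-+ k g x (λ g′ _ → gadget-≥-λ′ S g′) g<k
                                                             (gadget-≥-failures S j<h i<h bit)) ⟩
      cutValue network S
        ≡⟨ cutValue-deleteEdges network (row g j) (entry (suc g)) (entry g) (col g i) S (failures-valid g<k j<h i<h) ⟩
      cutValue (failedNetwork g j i) S + x ∎)
      where
      open ≤-Reasoning
      x = crosses S (row g j) (entry (suc g)) + crosses S (entry g) (col g i)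

  cutOf : (ℕ → Bool) → Subset n
  cutOf P = Vec.tabulate (P ∘ toℕ)

  lookup-cutOf : ∀ P {N} → N ≤ m → lookup (cutOf P) (vertex N) ≡ P N
  lookup-cutOf P N≤m = trans (lookup∘tabulate (P ∘ toℕ) _) (cong P (toℕ-vertex N≤m))

  crosses-into : ∀ P a {b} → b ≤ m → P b ≡ true → crosses (cutOf P) a (vertex b) ≡ 0
  crosses-into P a b≤m Pb rewrite lookup-cutOf P b≤m | Pb with lookup (cutOf P) a
  ... | true  = refl
  ... | false = refl

  crosses-from-outside : ∀ P {a} b → a ≤ m → P a ≡ false → crosses (cutOf P) (vertex a) b ≡ 0
  crosses-from-outside P b a≤m Pa rewrite lookup-cutOf P a≤m | Pa = refl

  crosses-out : ∀ P {a b} → a ≤ m → b ≤ m → P a ≡ true → P b ≡ false → crosses (cutOf P) (vertex a) (vertex b) ≡ 1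
  crosses-out P {a} {b} a≤m b≤m Pa Pb =
    crosses-≡1 (cutOf P) (vertex a) (vertex b) (trans (lookup-cutOf P a≤m) Pa) (trans (lookup-cutOf P b≤m) Pb)

  module Positions (fits : suc (k * width) ≤ m) where

    position-< : ∀ {g r} → g < k → r ≤ width → g * width + r < m
    position-< {g} {r} g<k r≤w = <-≤-trans (s≤s (begin
      g * width + r     ≤⟨ +-monoʳ-≤ (g * width) r≤w ⟩
      g * width + width ≡⟨ +-comm (g * width) width ⟩
      suc g * width     ≤⟨ *-monoˡ-≤ width g<k ⟩
      k * width         ∎)) fits
      where open ≤-Reasoning

    position-≤ : ∀ {g r} → g < k → r ≤ width → g * width + r ≤ m
    position-≤ g<k r≤w = <⇒≤ (position-< g<k r≤w)

    entry-≤ : ∀ {g} → g ≤ k → g * width ≤ m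
    entry-≤ g≤k = ≤-trans (*-monoˡ-≤ width g≤k) (<⇒≤ fits)

    row-offset-≤ : ∀ {j} → j < h → suc j ≤ width
    row-offset-≤ j<h = s≤s (≤-trans (<⇒≤ j<h) (m≤m+n h h))

    col-offset-≤ : ∀ {i} → i < h → suc (h + i) ≤ width
    col-offset-≤ i<h = s≤s (+-monoʳ-≤ h (<⇒≤ i<h))

    gadget-≡0 : ∀ S {g} → g < k →
      (∀ {r r′} → r ≤ width → r′ ≤ width → crosses S (vertex (g * width + r)) (vertex (g * width + r′)) ≡ 0) →
      cutValue (gadget g) S ≡ 0
    gadget-≡0 S {g} g<k none =
      trans (cutValue-gadget S g)
        (cong₂ _+_ (cong₂ _+_ (cong₂ _+_
          (Σ<-zero h λ j j<h → through≡0 (row-offset-≤ j<h))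
          (Σ<-zero h λ i i<h → through≡0 (col-offset-≤ i<h)))
          (trans (cong (d *_) (subst₂ (λ a b → crosses S a b ≡ 0) entry≡ exit≡ (none z≤n ≤-refl))) (*-zeroʳ d)))
          (Σ<-zero h λ j j<h → Σ<-zero h λ i i<h →
            trans (cong (if β g j i then_else 0) (none (row-offset-≤ j<h) (col-offset-≤ i<h))) (if-eta (β g j i))))
      where
      entry≡ : vertex (g * width + 0) ≡ entry g
      entry≡ = cong vertex (+-identityʳ (g * width))
      exit≡ : vertex (g * width + width) ≡ entry (suc g)
      exit≡ = cong vertex (+-comm (g * width) width)
      through≡0 : ∀ {r} → r ≤ width → through S g (vertex (g * width + r)) ≡ 0
      through≡0 {r} r≤w =
        cong₂ _+_ (subst (λ a → crosses S a (vertex (g * width + r)) ≡ 0) entry≡ (none z≤n r≤w))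
                  (subst (λ b → crosses S (vertex (g * width + r)) b ≡ 0) exit≡ (none r≤w ≤-refl))

    sourceSide : ℕ → Bool
    sourceSide N = does (N <? m)

    sourceSide-cut : cutValue network (cutOf sourceSide) ≡ λ′
    sourceSide-cut = begin
      cutValue network S
        ≡⟨ cutValue-network S ⟩
      Σ< k (λ g → cutValue (gadget g) S) + λ′ * crosses S (entry k) t
        ≡⟨ cong₂ _+_ (Σ<-zero k λ g g<k → gadget-≡0 S g<k λ {r} _ r′≤w →
                        crosses-into sourceSide (vertex (g * width + r)) (position-≤ g<k r′≤w) (dec-true (_ <? m) (position-< g<k r′≤w)))
                     (cong (λ′ *_) (crosses-out sourceSide (<⇒≤ fits) ≤-refl (dec-true (_ <? m) fits) (dec-false (m <? m) (n≮n m)))) ⟩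
      0 + λ′ * 1 ≡⟨ *-identityʳ λ′ ⟩
      λ′         ∎
      where
      open ≡-Reasoning
      S = cutOf sourceSide

    source∈sourceSide : vertex 0 ∈ cutOf sourceSide
    source∈sourceSide = lookup⇒[]= (vertex 0) (cutOf sourceSide)
      (trans (lookup-cutOf sourceSide z≤n) (dec-true (0 <? m) (<-≤-trans (s≤s z≤n) fits)))

    sink∉sourceSide : t ∉ cutOf sourceSide
    sink∉sourceSide t∈S
      with trans (sym ([]=⇒lookup t∈S)) (trans (lookup-cutOf sourceSide ≤-refl) (dec-false (m <? m) (n≮n m)))
    ... | ()

    hardInstance-minCut : h + h + d ≡ suc λ′ → HasMinCut hardInstance λ′
    hardInstance-minCut budget = (cutOf sourceSide , source∈sourceSide , sink∉sourceSide , sourceSide-cut)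
                               , network-≥ budget

    module QueryCut {gs js is} (gs<k : gs < k) (js<h : js < h) (is<h : is < h) where

      o : ℕ
      o = gs * width

      -- The positions up to the entry of gadget gs, its row js and its columns other than is.
      queryCut : ℕ → Bool
      queryCut N = does (N ≤? o) ∨ (does (N ℕ.≟ o + suc js) ∨
        (does (N ≤? o + (h + h)) ∧ (does (o + suc h ≤? N) ∧ not (does (N ℕ.≟ o + suc (h + is))))))

      queryCut-before : ∀ {N} → N ≤ o → queryCut N ≡ true
      queryCut-before {N} N≤o rewrite dec-true (N ≤? o) N≤o = refl

      queryCut-after : ∀ {N} → o + (h + h) < N → queryCut N ≡ false
      queryCut-after {N} o+2h<N
        rewrite dec-false (N ≤? o) (λ N≤o → <⇒≱ o+2h<N (≤-trans N≤o (m≤m+n o (h + h))))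
              | dec-false (N ℕ.≟ o + suc js) (λ { refl → <⇒≱ o+2h<N (+-monoʳ-≤ o (≤-trans js<h (m≤m+n h h))) })
              | dec-false (N ≤? o + (h + h)) (<⇒≱ o+2h<N) = refl

      queryCut-row : queryCut (o + suc js) ≡ true
      queryCut-row rewrite dec-false (o + suc js ≤? o) (m+1+n≰m o) | dec-true (o + suc js ℕ.≟ o + suc js) refl = refl

      queryCut-otherRow : ∀ {j} → j < h → j ≢ js → queryCut (o + suc j) ≡ false
      queryCut-otherRow {j} j<h j≢js
        rewrite dec-false (o + suc j ≤? o) (m+1+n≰m o)
              | dec-false (o + suc j ℕ.≟ o + suc js) (j≢js ∘ suc-injective ∘ +-cancelˡ-≡ o _ _)
              | dec-true (o + suc j ≤? o + (h + h)) (+-monoʳ-≤ o (≤-trans j<h (m≤m+n h h)))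
              | dec-false (o + suc h ≤? o + suc j) (<⇒≱ j<h ∘ s≤s⁻¹ ∘ +-cancelˡ-≤ o _ _) = refl

      queryCut-columns : ∀ {i} → i < h →
        queryCut (o + suc (h + i)) ≡ not (does (o + suc (h + i) ℕ.≟ o + suc (h + is)))
      queryCut-columns {i} i<h
        rewrite dec-false (o + suc (h + i) ≤? o) (m+1+n≰m o)
              | dec-false (o + suc (h + i) ℕ.≟ o + suc js)
                          (λ eq → <⇒≢ (≤-trans js<h (m≤m+n h i)) (suc-injective (+-cancelˡ-≡ o _ _ (sym eq))))
              | dec-true (o + suc (h + i) ≤? o + (h + h)) (+-monoʳ-≤ o (+-monoʳ-< h i<h))
              | dec-true (o + suc h ≤? o + suc (h + i)) (+-monoʳ-≤ o (s≤s (m≤m+n h i))) = refl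

      queryCut-col : queryCut (o + suc (h + is)) ≡ false
      queryCut-col = trans (queryCut-columns is<h) (cong not (dec-true (o + suc (h + is) ℕ.≟ o + suc (h + is)) refl))

      queryCut-otherCol : ∀ {i} → i < h → i ≢ is → queryCut (o + suc (h + i)) ≡ true
      queryCut-otherCol {i} i<h i≢is = trans (queryCut-columns i<h)
        (cong not (dec-false (o + suc (h + i) ℕ.≟ o + suc (h + is)) (i≢is ∘ +-cancelˡ-≡ h _ _ ∘ suc-injective ∘ +-cancelˡ-≡ o _ _)))

      S : Subset n
      S = cutOf queryCut

      private
        exit-above : o + (h + h) < suc gs * width
        exit-above = subst (o + (h + h) <_) (+-comm o width) (+-monoʳ-< o (n<1+n (h + h)))

      gadget-elsewhere : ∀ g → g < k → g ≢ gs → cutValue (gadget g) S ≡ 0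
      gadget-elsewhere g g<k g≢gs with <-cmp g gs
      ... | tri< g<gs _ _ = gadget-≡0 S g<k λ {r} _ r′≤w →
        crosses-into queryCut (vertex (g * width + r)) (position-≤ g<k r′≤w)
          (queryCut-before (≤-trans (+-monoʳ-≤ (g * width) r′≤w)
                           (≤-trans (≤-reflexive (+-comm (g * width) width)) (*-monoˡ-≤ width g<gs))))
      ... | tri≈ _ g≡gs _ = ⊥-elim (g≢gs g≡gs)
      ... | tri> _ _ gs<g = gadget-≡0 S g<k λ {r} {r′} r≤w _ →
        crosses-from-outside queryCut (vertex (g * width + r′)) (position-≤ g<k r≤w)
          (queryCut-after (<-≤-trans exit-above (≤-trans (*-monoˡ-≤ width gs<g) (m≤m+n (g * width) r))))

      entry∈S : lookup S (entry gs) ≡ true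
      entry∈S = trans (lookup-cutOf queryCut (entry-≤ (<⇒≤ gs<k))) (queryCut-before ≤-refl)

      exit∉S : lookup S (entry (suc gs)) ≡ false
      exit∉S = trans (lookup-cutOf queryCut (entry-≤ gs<k)) (queryCut-after exit-above)

      bit-crossing : ∀ {j i} → j < h → i < h → β gs js is ≡ false →
        (if β gs j i then crosses S (row gs j) (col gs i) else 0) ≡ 0
      bit-crossing {j} {i} j<h i<h bit with j ℕ.≟ js | i ℕ.≟ is
      ... | no j≢js | _ = trans (cong (if β gs j i then_else 0)
              (crosses-from-outside queryCut (col gs i) (position-≤ gs<k (row-offset-≤ j<h)) (queryCut-otherRow j<h j≢js)))
              (if-eta (β gs j i))
      ... | yes refl | no i≢is = trans (cong (if β gs j i then_else 0)
              (crosses-into queryCut (row gs j) (position-≤ gs<k (col-offset-≤ i<h)) (queryCut-otherCol i<h i≢is)))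
              (if-eta (β gs j i))
      ... | yes refl | yes refl rewrite bit = refl

      gadget-here : h + h + d ≡ suc λ′ → β gs js is ≡ false → cutValue (gadget gs) S ≡ suc λ′
      gadget-here budget bit = begin
        cutValue (gadget gs) S ≡⟨ cutValue-gadget S gs ⟩
        Σ< h (λ j → through S gs (row gs j)) + Σ< h (λ i → through S gs (col gs i)) + d * link S gs + bitCrossings S gs
          ≡⟨ cong₂ _+_ (cong₂ _+_ (cong₂ _+_ (Σ<-const h 1 (λ j _ → through≡1 (row gs j)))
                                             (Σ<-const h 1 (λ i _ → through≡1 (col gs i))))
                                  (cong (d *_) (crosses-≡1 S (entry gs) (entry (suc gs)) entry∈S exit∉S)))
                       (Σ<-zero h λ j j<h → Σ<-zero h λ i i<h → bit-crossing j<h i<h bit) ⟩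
        h * 1 + h * 1 + d * 1 + 0 ≡⟨ ones h d ⟩
        h + h + d ≡⟨ budget ⟩
        suc λ′ ∎
        where
        open ≡-Reasoning
        ones : ∀ h d → h * 1 + h * 1 + d * 1 + 0 ≡ h + h + d
        ones = solve-∀
        through≡1 : ∀ x → through S gs x ≡ 1
        through≡1 x = crosses-through S (entry gs) x (entry (suc gs)) entry∈S exit∉S

      source∈S : vertex 0 ∈ S
      source∈S = lookup⇒[]= (vertex 0) S (trans (lookup-cutOf queryCut z≤n) (queryCut-before z≤n))

      sink∉S : t ∉ S
      sink∉S t∈S with trans (sym ([]=⇒lookup t∈S))
                            (trans (lookup-cutOf queryCut ≤-refl)
                                   (queryCut-after (<-≤-trans exit-above (≤-trans (*-monoˡ-≤ width gs<k) (entry-≤ ≤-refl)))))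
      ... | ()

      failedNetwork-< : h + h + d ≡ suc λ′ → β gs js is ≡ false → suc (cutValue (failedNetwork gs js is) S) ≤ λ′
      failedNetwork-< budget bit = ≤-reflexive (suc-injective (begin
        suc (suc c)           ≡⟨ +-comm 2 c ⟩
        c + (1 + 1)           ≡⟨ cong (c +_) (cong₂ _+_ rowExit colEntry) ⟨
        c + (crosses S (row gs js) (entry (suc gs)) + crosses S (entry gs) (col gs is))
          ≡⟨ cutValue-deleteEdges network (row gs js) (entry (suc gs)) (entry gs) (col gs is) S
                                  (failures-valid gs<k js<h is<h) ⟨
        cutValue network S    ≡⟨ cutValue-network S ⟩
        Σ< k (λ g → cutValue (gadget g) S) + λ′ * crosses S (entry k) t
          ≡⟨ cong₂ _+_ (Σ<-single-≡ k gs gs<k gadget-elsewhere)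
                       (cong (λ′ *_) (crosses-from-outside queryCut t (entry-≤ ≤-refl)
                                        (queryCut-after (<-≤-trans exit-above (*-monoˡ-≤ width gs<k))))) ⟩
        cutValue (gadget gs) S + λ′ * 0
                              ≡⟨ cong₂ _+_ (gadget-here budget bit) (*-zeroʳ λ′) ⟩
        suc λ′ + 0            ≡⟨ +-identityʳ (suc λ′) ⟩
        suc λ′                ∎))
        where
        open ≡-Reasoning
        c = cutValue (failedNetwork gs js is) S
        rowExit : crosses S (row gs js) (entry (suc gs)) ≡ 1
        rowExit = crosses-≡1 S (row gs js) (entry (suc gs))
          (trans (lookup-cutOf queryCut (position-≤ gs<k (row-offset-≤ js<h))) queryCut-row) exit∉S
        colEntry : crosses S (entry gs) (col gs is) ≡ 1
        colEntry = crosses-≡1 S (entry gs) (col gs is) entry∈S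
          (trans (lookup-cutOf queryCut (position-≤ gs<k (col-offset-≤ is<h))) queryCut-col)

    failedNetwork-minCut : h + h + d ≡ suc λ′ → ∀ {g j i c} → g < k → j < h → i < h →
      IsMinCutSize (failedNetwork g j i) (vertex 0) t c → does (λ′ ≤? c) ≡ β g j i
    failedNetwork-minCut budget {g} {j} {i} {c} g<k j<h i<h ((S , s∈S , t∉S , cut≡c) , minimal) with β g j i in bit
    ... | true  = dec-true (λ′ ≤? c) (subst (λ′ ≤_) cut≡c (failedNetwork-≥ budget g<k j<h i<h bit S s∈S t∉S))
    ... | false = dec-false (λ′ ≤? c) (<⇒≱ (<-≤-trans (s≤s (minimal _ source∈S sink∉S)) (failedNetwork-< budget bit)))
      where open QueryCut g<k j<h i<h

-- Counting bit strings

toℕᵇ : List Bool → ℕᵇ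
toℕᵇ []           = ℕᵇ.zero
toℕᵇ (false ∷ bs) = 1+[2 toℕᵇ bs ]
toℕᵇ (true  ∷ bs) = 2[1+ toℕᵇ bs ]

toℕᵇ-injective : ∀ bs cs → toℕᵇ bs ≡ toℕᵇ cs → bs ≡ cs
toℕᵇ-injective []           []           _  = refl
toℕᵇ-injective (false ∷ bs) (false ∷ cs) eq = cong (false ∷_) (toℕᵇ-injective bs cs (1+[2_]-injective eq))
toℕᵇ-injective (true  ∷ bs) (true  ∷ cs) eq = cong (true ∷_) (toℕᵇ-injective bs cs (2[1+_]-injective eq))
toℕᵇ-injective []           (false ∷ _)  ()
toℕᵇ-injective []           (true  ∷ _)  ()
toℕᵇ-injective (false ∷ _)  []           ()
toℕᵇ-injective (false ∷ _)  (true  ∷ _)  ()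
toℕᵇ-injective (true  ∷ _)  []           ()
toℕᵇ-injective (true  ∷ _)  (false ∷ _)  ()

toℕ-toℕᵇ-< : ∀ bs → 2 + ℕᵇ.toℕ (toℕᵇ bs) ≤ 2 ^ suc (length bs)
toℕ-toℕᵇ-< []           = ≤-refl
toℕ-toℕᵇ-< (false ∷ bs) = ≤-trans (n≤1+n _) (≤-trans (≤-reflexive (sym (*-distribˡ-+ 2 2 (ℕᵇ.toℕ (toℕᵇ bs)))))
                                                     (*-monoʳ-≤ 2 (toℕ-toℕᵇ-< bs)))
toℕ-toℕᵇ-< (true  ∷ bs) = ≤-trans (≤-reflexive (sym (*-distribˡ-+ 2 1 (suc (ℕᵇ.toℕ (toℕᵇ bs))))))
                                  (*-monoʳ-≤ 2 (toℕ-toℕᵇ-< bs))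

long-string : ∀ B (F : Fin (2 ^ B) → List Bool) → (∀ x y → F x ≡ F y → x ≡ y) → ∃[ x ] B ≤ suc (length (F x))
long-string zero    F F-inj = zero , z≤n
long-string (suc B) F F-inj with any? (λ x → suc B ≤? suc (length (F x)))
... | yes long = long
... | no  none = ⊥-elim (Finₚ.<⇒≢ x<y (F-inj x y (toℕᵇ-injective _ _ (toℕ-injective
                   (fromℕ<-injective _ _ (code< x) (code< y) fx≡fy)))))
  where
  code : Fin (2 ^ suc B) → ℕ
  code x = ℕᵇ.toℕ (toℕᵇ (F x))
  code< : ∀ x → code x < 2 ^ B
  code< x = ≤-trans (n≤1+n _) (≤-trans (toℕ-toℕᵇ-< (F x))
              (^-monoʳ-≤ 2 (s≤s⁻¹ (≰⇒> (λ long → none (x , long))))))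
  collision = pigeonhole (^-monoʳ-< 2 (s≤s (s≤s z≤n)) (n<1+n B)) (λ x → fromℕ< (code< x))
  x = proj₁ collision
  y = proj₁ (proj₂ collision)
  x<y = proj₁ (proj₂ (proj₂ collision))
  fx≡fy = proj₂ (proj₂ (proj₂ collision))

-- Choice of the parameters

record Parameters (m λ′ : ℕ) : Set where
  field
    h d k  : ℕ
    budget : h + h + d ≡ suc λ′
    fits   : suc (k * suc (h + h)) ≤ m
    dense  : λ′ * suc m ≤ 42 * (k * (h * h)) + 42

dense-bound : ∀ {λ′ m h k} → 1 ≤ h → 1 ≤ k → λ′ ≤ h + h + 4 → m ≤ 2 * (k * suc (h + h)) →
              λ′ * suc m ≤ 42 * (k * (h * h))
dense-bound {λ′} {m} {h} {k} 1≤h 1≤k λ′≤ m≤ = begin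
  λ′ * suc m                   ≤⟨ *-mono-≤ λ′≤6h n≤7kh ⟩
  (6 * h) * (7 * (k * h))      ≡⟨ product h k ⟩
  42 * (k * (h * h))           ∎
  where
  open ≤-Reasoning
  six : ∀ h → h + h + 4 * h ≡ 6 * h
  six = solve-∀
  expand : ∀ k h → suc (2 * (k * suc (h + h))) ≡ 1 + 2 * k + 4 * (k * h)
  expand = solve-∀
  seven : ∀ x → x + 2 * x + 4 * x ≡ 7 * x
  seven = solve-∀
  product : ∀ h k → (6 * h) * (7 * (k * h)) ≡ 42 * (k * (h * h))
  product = solve-∀
  1≤kh : 1 ≤ k * h
  1≤kh = *-mono-≤ 1≤k 1≤h
  λ′≤6h : λ′ ≤ 6 * h
  λ′≤6h = begin
    λ′              ≤⟨ λ′≤ ⟩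
    h + h + 4 * 1   ≤⟨ +-monoʳ-≤ (h + h) (*-monoʳ-≤ 4 1≤h) ⟩
    h + h + 4 * h   ≡⟨ six h ⟩
    6 * h           ∎
  n≤7kh : suc m ≤ 7 * (k * h)
  n≤7kh = begin
    suc m                              ≤⟨ s≤s m≤ ⟩
    suc (2 * (k * suc (h + h)))        ≡⟨ expand k h ⟩
    1 + 2 * k + 4 * (k * h)            ≤⟨ +-monoˡ-≤ (4 * (k * h)) (+-mono-≤ 1≤kh (*-monoʳ-≤ 2 (m≤m*n k h {{ℕ.>-nonZero 1≤h}}))) ⟩
    k * h + 2 * (k * h) + 4 * (k * h)  ≡⟨ seven (k * h) ⟩
    7 * (k * h)                        ∎

-- h ≈ min(λ′, m) / 2, and as many gadgets as fit into the positions 1, …, m - 1.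
parameters-large : ∀ m′ λ′ → 1 ≤ λ′ → λ′ ≤ 3 + m′ → 2 ≤ m′ → Parameters (2 + m′) λ′
parameters-large m′ λ′ 1≤λ′ λ′≤n 2≤m′ = record
  { h = h ; d = suc λ′ ∸ (h + h) ; k = k
  ; budget = m+[n∸m]≡n (≤-trans 2h≤M (m⊓n≤m (suc λ′) m′))
  ; fits   = s≤s (m/n*n≤m (suc m′) width)
  ; dense  = ≤-trans (dense-bound 1≤h 1≤k λ′≤2h+4 m≤2kw) (m≤m+n _ 42)
  }
  where
  M h width k : ℕ
  M = suc λ′ ⊓ m′
  h = ⌊ M /2⌋
  width = suc (h + h)
  k = suc m′ / width

  2h≤M : h + h ≤ M
  2h≤M = ≤-trans (+-monoʳ-≤ h (⌊n/2⌋≤⌈n/2⌉ M)) (≤-reflexive (⌊n/2⌋+⌈n/2⌉≡n M))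

  M≤1+2h : M ≤ suc (h + h)
  M≤1+2h = begin
    M                ≡⟨ ⌊n/2⌋+⌈n/2⌉≡n M ⟨
    h + ⌈ M /2⌉      ≤⟨ +-monoʳ-≤ h (⌊n/2⌋-mono (n≤1+n (suc M))) ⟩
    h + suc h        ≡⟨ +-suc h h ⟩
    suc (h + h)      ∎
    where open ≤-Reasoning

  1≤h : 1 ≤ h
  1≤h = ⌊n/2⌋-mono {2} (⊓-glb (s≤s 1≤λ′) 2≤m′)

  1≤k : 1 ≤ k
  1≤k = m≥n⇒m/n>0 (s≤s (≤-trans 2h≤M (m⊓n≤n (suc λ′) m′)))

  λ′≤2h+4 : λ′ ≤ h + h + 4
  λ′≤2h+4 = s≤s⁻¹ (begin
    suc λ′                    ≤⟨ ⊓-glb (m≤m+n (suc λ′) 4) (≤-trans (s≤s λ′≤n) (≤-reflexive (+-comm 4 m′))) ⟩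
    (suc λ′ + 4) ⊓ (m′ + 4)   ≡⟨ +-distribʳ-⊓ 4 (suc λ′) m′ ⟨
    M + 4                     ≤⟨ +-monoˡ-≤ 4 M≤1+2h ⟩
    suc (h + h) + 4           ∎)
    where open ≤-Reasoning

  m≤2kw : 2 + m′ ≤ 2 * (k * width)
  m≤2kw = begin
    2 + m′                               ≡⟨ cong suc (m≡m%n+[m/n]*n (suc m′) width) ⟩
    suc (suc m′ % width + k * width)     ≤⟨ +-monoˡ-≤ (k * width) (m%n<n (suc m′) width) ⟩
    width + k * width                    ≤⟨ +-monoˡ-≤ (k * width) (m≤n*m width k {{ℕ.>-nonZero 1≤k}}) ⟩
    k * width + k * width                ≡⟨ cong (k * width +_) (+-identityʳ (k * width)) ⟨
    2 * (k * width)                      ∎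
    where open ≤-Reasoning

-- Too few vertices for a gadget: a single link of λ′ + 1 parallel edges.
parameters-small : ∀ m λ′ → 1 ≤ m → m ≤ 3 → λ′ ≤ suc m → Parameters m λ′
parameters-small m λ′ 1≤m m≤3 λ′≤n = record
  { h = 0 ; d = suc λ′ ; k = 0 ; budget = refl ; fits = 1≤m
  ; dense = ≤-trans (*-mono-≤ (≤-trans λ′≤n (s≤s m≤3)) (s≤s m≤3)) (m≤m+n 16 26)
  }

parameters : ∀ m λ′ → 1 ≤ m → 1 ≤ λ′ → λ′ ≤ suc m → Parameters m λ′
parameters m λ′ 1≤m 1≤λ′ λ′≤n with m ≤? 3
... | yes m≤3 = parameters-small m λ′ 1≤m m≤3 λ′≤n
parameters (suc (suc m′)) λ′ 1≤m 1≤λ′ λ′≤n | no m≰3 = parameters-large m′ λ′ 1≤λ′ λ′≤n (s≤s⁻¹ (s≤s⁻¹ (≰⇒> m≰3)))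
parameters 1 λ′ 1≤m 1≤λ′ λ′≤n | no m≰3 = ⊥-elim (m≰3 (s≤s z≤n))

-- The lower bound

toBool : Fin 2 → Bool
toBool zero       = false
toBool (suc zero) = true

toBool-injective : ∀ a b → toBool a ≡ toBool b → a ≡ b
toBool-injective zero       zero       _  = refl
toBool-injective (suc zero) (suc zero) _  = refl
toBool-injective zero       (suc zero) ()
toBool-injective (suc zero) zero       ()

funToFin-cong : ∀ {a b} {f g : Fin a → Fin b} → (∀ x → f x ≡ g x) → funToFin f ≡ funToFin g
funToFin-cong {zero}  f≗g = refl
funToFin-cong {suc a} f≗g = cong₂ combine (f≗g zero) (funToFin-cong (f≗g ∘ suc))

module HardFamily {m λ′} (parameters : Parameters m λ′) where

  open Parameters parameters
  open Layout m h

  B : ℕ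
  B = k * (h * h)

  bitAt : Fin (2 ^ B) → ℕ → Bool
  bitAt K N with N <? B
  ... | yes N<B = toBool (finToFun K (fromℕ< N<B))
  ... | no  _   = false

  bitAt-toℕ : ∀ K p → bitAt K (toℕ p) ≡ toBool (finToFun K p)
  bitAt-toℕ K p with toℕ p <? B
  ... | yes p<B = cong (toBool ∘ finToFun K) (fromℕ<-toℕ p p<B)
  ... | no  p≮B = ⊥-elim (p≮B (toℕ<n p))

  bits : Fin (2 ^ B) → ℕ → ℕ → ℕ → Bool
  bits K g j i = bitAt K (h * h * g + (h * j + i))

  module Hard (K : Fin (2 ^ B)) = Construction m λ′ h d k (bits K)

  hard : Fin (2 ^ B) → Instance n
  hard = Hard.hardInstance

  hard-minCut : ∀ K → HasMinCut (hard K) λ′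
  hard-minCut K = Hard.Positions.hardInstance-minCut K fits budget

  gadgetOf : Fin B → Fin k
  gadgetOf p = proj₁ (remQuot (h * h) p)

  rowOf colOf : Fin B → Fin h
  rowOf p = proj₁ (remQuot {h} h (proj₂ (remQuot {k} (h * h) p)))
  colOf p = proj₂ (remQuot {h} h (proj₂ (remQuot {k} (h * h) p)))

  bits-index : ∀ K p → bits K (toℕ (gadgetOf p)) (toℕ (rowOf p)) (toℕ (colOf p)) ≡ toBool (finToFun K p)
  bits-index K p = trans (cong (bitAt K) index) (bitAt-toℕ K p)
    where
    open ≡-Reasoning
    r = proj₂ (remQuot {k} (h * h) p)
    index : h * h * toℕ (gadgetOf p) + (h * toℕ (rowOf p) + toℕ (colOf p)) ≡ toℕ p
    index = begin
      h * h * toℕ (gadgetOf p) + (h * toℕ (rowOf p) + toℕ (colOf p))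
        ≡⟨ cong (h * h * toℕ (gadgetOf p) +_) (trans (sym (toℕ-combine (rowOf p) (colOf p))) (cong toℕ (combine-remQuot {h} h r))) ⟩
      h * h * toℕ (gadgetOf p) + toℕ r   ≡⟨ toℕ-combine (gadgetOf p) r ⟨
      toℕ (combine (gadgetOf p) r)       ≡⟨ cong toℕ (combine-remQuot {k} (h * h) p) ⟩
      toℕ p                              ∎

  module _ {enc : Instance n → List Bool} {q : List Bool → Edge n → Edge n → ℕ}
           (correct : CorrectOracle n λ′ enc q) where

    readBit : List Bool → Fin B → Bool
    readBit bs p = does (λ′ ≤? q bs (row g j , entry (suc g)) (entry g , col g i))
      where
      g = toℕ (gadgetOf p)
      j = toℕ (rowOf p)
      i = toℕ (colOf p)

    readBit-correct : ∀ K p → readBit (enc (hard K)) p ≡ toBool (finToFun K p)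
    readBit-correct K p = trans
      (Hard.Positions.failedNetwork-minCut K fits budget g<k j<h i<h
        (correct (hard K) (hard-minCut K) _ _ (Hard.failures-valid K g<k j<h i<h)))
      (bits-index K p)
      where
      g<k = toℕ<n (gadgetOf p)
      j<h = toℕ<n (rowOf p)
      i<h = toℕ<n (colOf p)

    encoding-injective : ∀ K K′ → enc (hard K) ≡ enc (hard K′) → K ≡ K′
    encoding-injective K K′ eq = begin
      K                                ≡⟨ funToFin-finToFin {B} {2} K ⟨
      funToFin (finToFun {2} {B} K)    ≡⟨ funToFin-cong same-bits ⟩
      funToFin (finToFun {2} {B} K′)   ≡⟨ funToFin-finToFin {B} {2} K′ ⟩
      K′                               ∎
      where
      open ≡-Reasoning
      same-bits : ∀ p → finToFun K p ≡ finToFun K′ p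
      same-bits p = toBool-injective _ _
        (trans (sym (readBit-correct K p)) (trans (cong (λ bs → readBit bs p) eq) (readBit-correct K′ p)))

    oracle-space : ∃[ I ] (HasMinCut I λ′ × λ′ * n ≤ 84 * length (enc I) + 84)
    oracle-space = hard K , hard-minCut K , (begin
      λ′ * n                  ≤⟨ dense ⟩
      42 * B + 42             ≤⟨ +-monoˡ-≤ 42 (*-monoʳ-≤ 42 B≤1+len) ⟩
      42 * suc len + 42       ≡⟨ rearrange len ⟩
      42 * len + 84           ≤⟨ +-monoˡ-≤ 84 (*-monoˡ-≤ len (m≤m+n 42 42)) ⟩
      84 * len + 84           ∎)
      where
      open ≤-Reasoning
      rearrange : ∀ x → 42 * suc x + 42 ≡ 42 * x + 84
      rearrange = solve-∀
      long = long-string B (enc ∘ hard) encoding-injective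
      K = proj₁ long
      B≤1+len = proj₂ long
      len = length (enc (hard K))

theorem4 : ∃[ c ] (1 ≤ c × (∀ (n λ' : ℕ) → 2 ≤ n → 1 ≤ λ' → λ' ≤ n →
             ∀ (enc : Instance n → List Bool) (q : List Bool → Edge n → Edge n → ℕ) →
             CorrectOracle n λ' enc q →
             ∃[ I ] (HasMinCut I λ' × λ' * n ≤ c * length (enc I) + c)))
theorem4 = 84 , s≤s z≤n , λ where
  (suc m) λ′ (s≤s 1≤m) 1≤λ′ λ′≤n enc q correct →
    HardFamily.oracle-space (parameters m λ′ 1≤m 1≤λ′ λ′≤n) {enc} {q} correct
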